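{- Let $G$ be a connected AT-free graph of diameter $d$, let $\{u,v\}$ be a diameter dominating pair of $G$, and let $s$ be an integer with $2\leq s<d$. If $G$ has a $(u,v)$-satisfying path $Q=x_0x_1\ldots x_k$ of length $k=d-s$ such that $u\neq x_0$ and $v\neq x_k$, then ${\rm diam}(G/E(Q))\leq s$.
   Context: All graphs are finite, simple and undirected. ${\rm diam}(G)$ is the maximum distance between two vertices; $\{u,v\}$ is a diameter pair if ${\rm dist}_G(u,v)={\rm diam}(G)$, a dominating pair if every $(u,v)$-path in $G$ has the property that every vertex of $G$ is on the path or adjacent to a vertex of the path, and a diameter dominating pair if it is both. An asteroidal triple is a set of three pairwise non-adjacent vertices such that between each pair there is a path containing no neighbor of the third; AT-free means having no asteroidal triple. For $S\subseteq E(G)$, $G/S$ is obtained by contracting all edges of $S$ (contracting $uv$ replaces $u,v$ by a new vertex adjacent to exactly the vertices adjacent to $u$ or $v$). For a $(u,v)$-path $P$, $x\prec_P y$ means ${\rm dist}_P(u,x)\leq{\rm dist}_P(u,y)$ and $x\neq y$. For a connected graph $G$ of diameter $d$ with diameter pair $\{u,v\}$, let $X_u=\{x\mid {\rm dist}_G(u,x)=d\}$, $Y_u=\{x\mid {\rm dist}_G(u,x)=d-1\}$, $X_v=\{x\mid {\rm dist}_G(v,x)=d\}$, $Y_v=\{x\mid {\rm dist}_G(v,x)=d-1\}$. A path $Q=x_0\ldots x_k$ is $(u,v)$-satisfying if: (i) $Q$ is a subpath of some $(u,v)$-path $P$ of length $d$ and $x_0\prec_P x_k$; (ii) ${\rm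 dist}_G(z,x_0)={\rm dist}_G(u,x_0)$ for every $z\in X_v$, and ${\rm dist}_G(z,x_k)={\rm dist}_G(v,x_k)$ for every $z\in X_u$; (iii) for every $z\in Y_v$, ${\rm dist}_G(z,x_0)\leq {\rm dist}_G(u,x_0)$ or ${\rm dist}_G(z,x_1)\leq {\rm dist}_G(u,x_0)$, and for every $z\in Y_u$, ${\rm dist}_G(z,x_k)\leq {\rm dist}_G(v,x_k)$ or ${\rm dist}_G(z,x_{k-1})\leq {\rm dist}_G(v,x_k)$. -}

module Defs where

open import Level using (0ℓ)
open import Data.Nat using (ℕ; zero; suc; _+_; _∸_; _≤_; _<_)
open import Data.Fin using (Fin)
open import Data.Product using (Σ; ∃; ∃-syntax; _×_; _,_)
open import Data.Sum using (_⊎_)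
open import Relation.Nullary using (¬_)
open import Relation.Binary.PropositionalEquality using (_≡_; _≢_)
open import Relation.Binary.Construct.Closure.Equivalence using (EqClosure)

record Graph (n : ℕ) : Set₁ where
  field
    Adj    : Fin n → Fin n → Set
    sym    : ∀ {x y} → Adj x y → Adj y x
    irrefl : ∀ x → ¬ Adj x x
open Graph public

module _ {n : ℕ} (G : Graph n) where

  data Walk : Fin n → Fin n → ℕ → Set where
    wnil  : ∀ {x} → Walk x x 0
    wcons : ∀ {x y z m} → Adj G x y → Walk y z m → Walk x z (suc m)

  Dist : Fin n → Fin n → ℕ → Set
  Dist x y k = Walk x y k × (∀ m → Walk x y m → k ≤ m)

  DistEq : Fin n → Fin n → Fin n → Fin n → Set
  DistEq a b c e = ∃[ m ] (Dist a b m × Dist c e m)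

  DistLe : Fin n → Fin n → Fin n → Fin n → Set
  DistLe a b c e = ∃[ m ] ∃[ m' ] (Dist a b m × Dist c e m' × m ≤ m')

  Connected : Set
  Connected = ∀ x y → ∃[ k ] Walk x y k

  Diameter : ℕ → Set
  Diameter d = (∀ x y → ∃[ k ] (Dist x y k × k ≤ d))
             × (∃[ x ] ∃[ y ] Dist x y d)

  -- a (u,v)-path: vertices p 0 = u, ..., p len = v, pairwise distinct,
  -- consecutive ones adjacent (values of p beyond len are irrelevant)
  record Path (u v : Fin n) : Set where
    field
      len    : ℕ
      vert   : ℕ → Fin n
      start  : vert 0 ≡ u
      end    : vert len ≡ v
      step   : ∀ i → i < len → Adj G (vert i) (vert (suc i))
      inj    : ∀ i j → i ≤ len → j ≤ len → vert i ≡ vert j → i ≡ j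
  open Path public

  DiameterPair : ℕ → Fin n → Fin n → Set
  DiameterPair d u v = Diameter d × Dist u v d

  DominatingPair : Fin n → Fin n → Set
  DominatingPair u v = (P : Path u v) → ∀ w →
    ∃[ i ] (i ≤ len P × (vert P i ≡ w ⊎ Adj G w (vert P i)))

  DiameterDominatingPair : ℕ → Fin n → Fin n → Set
  DiameterDominatingPair d u v = DiameterPair d u v × DominatingPair u v

  Avoids : ∀ {a b} → Path a b → Fin n → Set
  Avoids P c = ∀ i → i ≤ len P → (vert P i ≢ c) × ¬ Adj G (vert P i) c

  AsteroidalTriple : Fin n → Fin n → Fin n → Set
  AsteroidalTriple a b c =
    (a ≢ b) × (b ≢ c) × (a ≢ c) ×
    ¬ Adj G a b × ¬ Adj G b c × ¬ Adj G a c ×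
    (∃[ P ] Avoids {a} {b} P c) ×
    (∃[ P ] Avoids {b} {c} P a) ×
    (∃[ P ] Avoids {a} {c} P b)

  AT-free : Set
  AT-free = ∀ a b c → ¬ AsteroidalTriple a b c

  Satisfying : ℕ → Fin n → Fin n → ℕ → (ℕ → Fin n) → Set
  Satisfying d u v k x =
    -- (i) Q is a subpath of a (u,v)-path P of length d, traversed from
    --     x 0 = P_j to x k = P_(j+k) (this encodes x_0 ≺_P x_k), and x 0 ≠ x k
    (∃[ P ] (len {u} {v} P ≡ d × ∃[ j ] (j + k ≤ d ×
        (∀ i → i ≤ k → x i ≡ vert P (j + i)))))
    × (x 0 ≢ x k)
    × (∀ z → Dist v z d → DistEq z (x 0) u (x 0))
    × (∀ z → Dist u z d → DistEq z (x k) v (x k))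
    × (∀ z → Dist v z (d ∸ 1) →
         DistLe z (x 0) u (x 0) ⊎ DistLe z (x 1) u (x 0))
    × (∀ z → Dist u z (d ∸ 1) →
         DistLe z (x k) v (x k) ⊎ DistLe z (x (k ∸ 1)) v (x k))

-- Contraction G/S of an edge set S (given as a relation on vertices).
-- Vertices of G/S are the classes of the equivalence relation generated
-- by S; we represent a class by any of its members.

module _ {n : ℕ} (G : Graph n) (S : Fin n → Fin n → Set) where

  _≈S_ : Fin n → Fin n → Set
  a ≈S b = EqClosure S a b

  data CWalk : Fin n → Fin n → ℕ → Set where
    cnil  : ∀ {x z} → x ≈S z → CWalk x z 0
    ccons : ∀ {x a b z m} → x ≈S a → Adj G a b → ¬ (a ≈S b) →
            CWalk b z m → CWalk x z (suc m)

  CDist : Fin n → Fin n → ℕ → Set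
  CDist x z k = CWalk x z k × (∀ m → CWalk x z m → k ≤ m)

  ContractDiamAtMost : ℕ → Set
  ContractDiamAtMost s = ∀ x y → ∃[ k ] (CDist x y k × k ≤ s)

PathEdges : ∀ {n} → ℕ → (ℕ → Fin n) → Fin n → Fin n → Set
PathEdges k x a b = ∃[ i ] (i < k ×
  ((a ≡ x i × b ≡ x (suc i)) ⊎ (a ≡ x (suc i) × b ≡ x i)))

-- Write L = dist(u, x₀) and R = dist(xₖ, v), so that d = L + k + R and s = L + R.  Since {u,v}
-- is dominating, every vertex w is equal or adjacent to a vertex p_t of the diametral path P.
-- If p_t lies strictly before x₀, then w is within L of Q: for t > 0 by walking along P, and
-- for t = 0 because dist(v,w) ∈ {d, d-1} and conditions (ii), (iii) bound the distance from w
-- to x₀ or x₁ by dist(u,x₀).  Symmetrically beyond xₖ, and within 1 of Q between x₀ and xₖ.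
-- In G/E(Q) the path Q is a single vertex, so two vertices meet through it within L + R,
-- except when both lie on the same side, where P itself joins them within L + 1 or R + 1.
module Submission where

open import Defs
open import Data.Nat using (ℕ; zero; suc; _+_; _∸_; _≤_; _<_; z≤n; s≤s; s≤s⁻¹; _≤?_; _<?_)
open import Data.Nat.Properties
open import Data.Fin using (Fin; toℕ; fromℕ<)
open import Relation.Binary.PropositionalEquality using (_≡_; _≢_)
open import Data.Fin.Properties using (any?; toℕ≤pred[n]; toℕ-fromℕ<) renaming (_≟_ to _≟ᶠ_)
open import Data.Product using (∃-syntax; _×_; _,_; proj₁; proj₂; swap)
open import Data.Sum as Sum using (_⊎_; inj₁; inj₂; [_,_]′)
open import Data.Empty using (⊥-elim)
open import Function using (id)
open import Relation.Nullary using (¬_; Dec)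
open import Relation.Nullary.Decidable using (_×-dec_; _⊎-dec_; ¬?; map′; yes; no)
import Relation.Binary.PropositionalEquality as ≡
open ≡ using (refl; trans; cong; subst; subst₂)
open import Relation.Binary.Construct.Closure.ReflexiveTransitive using (ε; _◅_; _◅◅_)
open import Relation.Binary.Construct.Closure.Symmetric using (SymClosure; fwd; bwd)
open import Relation.Binary.Construct.Closure.Equivalence using (EqClosure)
  renaming (symmetric to ≈-sym)

≤-≤suc⇒≡⊎≡∸1 : ∀ {m d} → m ≤ d → d ≤ suc m → m ≡ d ⊎ m ≡ d ∸ 1
≤-≤suc⇒≡⊎≡∸1 m≤d d≤1+m with m≤n⇒m<n∨m≡n m≤d
... | inj₁ m<d = inj₂ (cong (_∸ 1) (≤-antisym m<d d≤1+m))
... | inj₂ m≡d = inj₁ m≡d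

module _ {P : ℕ → Set} (P? : ∀ m → Dec (P m)) where

  Least : ℕ → Set
  Least m₀ = P m₀ × (∀ m → P m → m₀ ≤ m)

  least-≤-or-none : ∀ m → (∃[ m₀ ] (m₀ ≤ m × Least m₀)) ⊎ (∀ m' → m' ≤ m → ¬ P m')
  least-≤-or-none zero with P? zero
  ... | yes p₀ = inj₁ (0 , z≤n , p₀ , λ _ _ → z≤n)
  ... | no ¬p₀ = inj₂ λ { _ z≤n → ¬p₀ }
  least-≤-or-none (suc m) with least-≤-or-none m
  ... | inj₁ (m₀ , m₀≤m , least) = inj₁ (m₀ , m≤n⇒m≤1+n m₀≤m , least)
  ... | inj₂ none with P? (suc m)
  ...   | yes p = inj₁ (suc m , ≤-refl , p , λ m' p' → ≰⇒> λ m'≤m → none m' m'≤m p')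
  ...   | no ¬p = inj₂ λ m' m'≤1+m p' →
            [ (λ m'<1+m → none m' (s≤s⁻¹ m'<1+m) p') , (λ e → ¬p (subst P e p')) ]′
              (m≤n⇒m<n∨m≡n m'≤1+m)

  least-witness : ∀ {m} → P m → ∃[ m₀ ] (m₀ ≤ m × Least m₀)
  least-witness {m} p = [ id , (λ none → ⊥-elim (none m ≤-refl p)) ]′ (least-≤-or-none m)

module Walks {n : ℕ} (G : Graph n) where

  snoc : ∀ {a b c m} → Walk G a b m → Adj G b c → Walk G a c (suc m)
  snoc wnil e = wcons e wnil
  snoc (wcons e w) e' = wcons e (snoc w e')

  reverse : ∀ {a b m} → Walk G a b m → Walk G b a m
  reverse wnil = wnil
  reverse (wcons e w) = snoc (reverse w) (sym G e)

  _++ʷ_ : ∀ {a b c m m'} → Walk G a b m → Walk G b c m' → Walk G a c (m + m')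
  wnil ++ʷ w' = w'
  wcons e w ++ʷ w' = wcons e (w ++ʷ w')

  WalkWithin : Fin n → Fin n → ℕ → Set
  WalkWithin a b m = ∃[ m' ] (m' ≤ m × Walk G a b m')

  walk⇒within : ∀ {a b m} → Walk G a b m → WalkWithin a b m
  walk⇒within w = _ , ≤-refl , w

  within-mono : ∀ {a b m m'} → WalkWithin a b m → m ≤ m' → WalkWithin a b m'
  within-mono (l , l≤m , w) m≤m' = l , ≤-trans l≤m m≤m' , w

  within-reverse : ∀ {a b m} → WalkWithin a b m → WalkWithin b a m
  within-reverse (l , l≤m , w) = l , l≤m , reverse w

  within-++ : ∀ {a b c m m'} → WalkWithin a b m → WalkWithin b c m' → WalkWithin a c (m + m')
  within-++ (l , l≤m , w) (l' , l'≤m' , w') = l + l' , +-mono-≤ l≤m l'≤m' , w ++ʷ w'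

  dist-sym : ∀ {a b d} → Dist G a b d → Dist G b a d
  dist-sym (w , least) = reverse w , λ m w' → least m (reverse w')

  dist-≤-within : ∀ {a b d m} → Dist G a b d → WalkWithin a b m → d ≤ m
  dist-≤-within (_ , least) (l , l≤m , w) = ≤-trans (least l w) l≤m

  distEq⇒within : ∀ {z y u a} → DistEq G z y u y → Walk G u y a → WalkWithin z y a
  distEq⇒within (m , (w , _) , (_ , least)) u→y = m , least _ u→y , w

  distLe⇒within : ∀ {z y y' u a} → DistLe G z y' u y → Walk G u y a → WalkWithin z y' a
  distLe⇒within (m , m' , (w , _) , (_ , least) , m≤m') u→y = m , ≤-trans m≤m' (least _ u→y) , w

  adjacent? : ∀ {d} → Diameter G d → ∀ a b → Dec (Adj G a b)
  adjacent? (bounded , _) a b with bounded a b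
  ... | zero , (wnil , _) , _ = no (irrefl G a)
  ... | suc zero , (wcons e wnil , _) , _ = yes e
  ... | suc (suc m) , (_ , least) , _ = no λ e → 2+m≰1 (least 1 (wcons e wnil))
    where
    2+m≰1 : ¬ suc (suc m) ≤ 1
    2+m≰1 (s≤s ())

  -- Only dist(v,w) ∈ {d, d-1} matters, which holds for any w within 1 of u.
  near-diametral-end : ∀ {d u v w y y' a} → Diameter G d → Dist G u v d →
    WalkWithin w u 1 → Walk G u y a →
    (∀ z → Dist G v z d → DistEq G z y u y) →
    (∀ z → Dist G v z (d ∸ 1) → DistLe G z y u y ⊎ DistLe G z y' u y) →
    WalkWithin w y a ⊎ WalkWithin w y' a
  near-diametral-end {v = v} {w} (bounded , _) duv w~u u→y far near-far
    with bounded v w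
  ... | m , dvw , m≤d
    with ≤-≤suc⇒≡⊎≡∸1 m≤d
           (dist-≤-within duv (within-++ (within-reverse w~u) (within-reverse (walk⇒within (proj₁ dvw)))))
  ... | inj₁ refl = inj₁ (distEq⇒within (far w dvw) u→y)
  ... | inj₂ refl = Sum.map (λ h → distLe⇒within h u→y) (λ h → distLe⇒within h u→y) (near-far w dvw)

  module _ {u v : Fin n} (P : Path G u v) where

    segment : ∀ m t → m + t ≤ len P → Walk G (vert P t) (vert P (m + t)) m
    segment zero t _ = wnil
    segment (suc m) t m+t<len = snoc (segment m t (<⇒≤ m+t<len)) (step P (m + t) m+t<len)

    segment-within-≤ : ∀ {t₁ t₂ c} → t₁ ≤ t₂ → t₂ ≤ len P → t₂ ≤ t₁ + c →
      WalkWithin (vert P t₁) (vert P t₂) c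
    segment-within-≤ {t₁} {t₂} t₁≤t₂ t₂≤len t₂≤t₁+c =
      t₂ ∸ t₁ , m≤n+o⇒m∸n≤o t₂ t₁ t₂≤t₁+c ,
      subst (λ t → Walk G (vert P t₁) (vert P t) (t₂ ∸ t₁)) (m∸n+n≡m t₁≤t₂)
        (segment (t₂ ∸ t₁) t₁ (subst (_≤ len P) (≡.sym (m∸n+n≡m t₁≤t₂)) t₂≤len))

    segment-within : ∀ {t₁ t₂ c} → t₁ ≤ len P → t₂ ≤ len P → t₁ ≤ t₂ + c → t₂ ≤ t₁ + c →
      WalkWithin (vert P t₁) (vert P t₂) c
    segment-within {t₁} {t₂} t₁≤len t₂≤len t₁≤t₂+c t₂≤t₁+c with ≤-total t₁ t₂
    ... | inj₁ t₁≤t₂ = segment-within-≤ t₁≤t₂ t₂≤len t₂≤t₁+c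
    ... | inj₂ t₂≤t₁ = within-reverse (segment-within-≤ t₂≤t₁ t₁≤len t₁≤t₂+c)

    dominated-within : ∀ {a b t₁ t₂ c} → WalkWithin a (vert P t₁) 1 → WalkWithin b (vert P t₂) 1 →
      t₁ ≤ len P → t₂ ≤ len P → t₁ ≤ t₂ + c → t₂ ≤ t₁ + c → WalkWithin a b (suc c + 1)
    dominated-within a~ b~ t₁≤len t₂≤len t₁≤ t₂≤ =
      within-++ (within-++ a~ (segment-within t₁≤len t₂≤len t₁≤ t₂≤)) (within-reverse b~)

    dominated : DominatingPair G u v → ∀ w → ∃[ t ] (t ≤ len P × WalkWithin w (vert P t) 1)
    dominated dom w with dom P w
    ... | t , t≤len , inj₁ p≡w = t , t≤len , 0 , z≤n , subst (λ a → Walk G a (vert P t) 0) p≡w wnil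
    ... | t , t≤len , inj₂ adj = t , t≤len , walk⇒within (wcons adj wnil)

module Contraction {n : ℕ} (G : Graph n) (S : Fin n → Fin n → Set) where
  open Walks G using (WalkWithin)

  CWalkWithin : Fin n → Fin n → ℕ → Set
  CWalkWithin a b m = ∃[ m' ] (m' ≤ m × CWalk G S a b m')

  cwalk-from : ∀ {a a' b m} → _≈S_ G S a a' → CWalk G S a' b m → CWalk G S a b m
  cwalk-from a≈a' (cnil a'≈b) = cnil (a≈a' ◅◅ a'≈b)
  cwalk-from a≈a' (ccons a'≈c e c≉c' w) = ccons (a≈a' ◅◅ a'≈c) e c≉c' w

  cwalk-join : ∀ {a b c c' m m'} → CWalk G S a c m → _≈S_ G S c c' → CWalk G S c' b m' →
    CWalk G S a b (m + m')
  cwalk-join (cnil a≈c) c≈c' w = cwalk-from (a≈c ◅◅ c≈c') w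
  cwalk-join (ccons a≈e e e≉f w) c≈c' w' = ccons a≈e e e≉f (cwalk-join w c≈c' w')

  cwithin-join : ∀ {a b c c' m m'} → CWalkWithin a c m → _≈S_ G S c c' → CWalkWithin c' b m' →
    CWalkWithin a b (m + m')
  cwithin-join (l , l≤m , w) c≈c' (l' , l'≤m' , w') = l + l' , +-mono-≤ l≤m l'≤m' , cwalk-join w c≈c' w'

  cwithin-mono : ∀ {a b m m'} → CWalkWithin a b m → m ≤ m' → CWalkWithin a b m'
  cwithin-mono (l , l≤m , w) m≤m' = l , ≤-trans l≤m m≤m' , w

  module _ (_≈?_ : ∀ a b → Dec (_≈S_ G S a b)) where

    walk⇒cwithin : ∀ {a b m} → Walk G a b m → CWalkWithin a b m
    walk⇒cwithin wnil = 0 , z≤n , cnil ε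
    walk⇒cwithin (wcons {a} {c} e w) with walk⇒cwithin w | a ≈? c
    ... | l , l≤m , cw | yes a≈c = l , m≤n⇒m≤1+n l≤m , cwalk-from a≈c cw
    ... | l , l≤m , cw | no a≉c = suc l , s≤s l≤m , ccons ε e a≉c cw

    within⇒cwithin : ∀ {a b m} → WalkWithin a b m → CWalkWithin a b m
    within⇒cwithin (l , l≤m , w) = cwithin-mono (walk⇒cwithin w) l≤m

    module _ (adj? : ∀ a b → Dec (Adj G a b)) where

      cwalk? : ∀ a b m → Dec (CWalk G S a b m)
      cwalk? a b zero = map′ cnil (λ { (cnil a≈b) → a≈b }) (a ≈? b)
      cwalk? a b (suc m) =
        map′ (λ (_ , _ , a≈c , e , c≉c' , w) → ccons a≈c e c≉c' w)
             (λ { (ccons a≈c e c≉c' w) → _ , _ , a≈c , e , c≉c' , w })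
             (any? λ c → any? λ c' →
               (a ≈? c) ×-dec adj? c c' ×-dec ¬? (c ≈? c') ×-dec cwalk? c' b m)

      contract-diam-≤ : ∀ {s} → (∀ a b → CWalkWithin a b s) → ContractDiamAtMost G S s
      contract-diam-≤ within a b with within a b
      ... | m , m≤s , w with least-witness (cwalk? a b) w
      ...   | m₀ , m₀≤m , least = m₀ , least , ≤-trans m₀≤m m≤s

module PathContraction {n : ℕ} (k : ℕ) (x : ℕ → Fin n) where

  _≈_ : Fin n → Fin n → Set
  _≈_ = EqClosure (PathEdges k x)

  OnPath : Fin n → Set
  OnPath a = ∃[ i ] (i ≤ k × a ≡ x i)

  on-path? : ∀ a → Dec (OnPath a)
  on-path? a =
    map′ (λ (i , a≡xi) → toℕ i , toℕ≤pred[n] i , a≡xi)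
         (λ (i , i≤k , a≡xi) →
           fromℕ< (s≤s i≤k) , subst (λ j → a ≡ x j) (≡.sym (toℕ-fromℕ< (s≤s i≤k))) a≡xi)
         (any? λ i → a ≟ᶠ x (toℕ i))

  ≈-x₀ : ∀ i → i ≤ k → x i ≈ x 0
  ≈-x₀ zero _ = ε
  ≈-x₀ (suc i) i<k = fwd (i , i<k , inj₂ (refl , refl)) ◅ ≈-x₀ i (<⇒≤ i<k)

  on-path-≈ : ∀ {a b} → OnPath a → OnPath b → a ≈ b
  on-path-≈ (i , i≤k , refl) (j , j≤k , refl) = ≈-x₀ i i≤k ◅◅ ≈-sym (PathEdges k x) (≈-x₀ j j≤k)

  edge-on-path : ∀ {a b} → PathEdges k x a b → OnPath a × OnPath b
  edge-on-path (i , i<k , inj₁ (a≡ , b≡)) = (i , <⇒≤ i<k , a≡) , (suc i , i<k , b≡)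
  edge-on-path (i , i<k , inj₂ (a≡ , b≡)) = (suc i , i<k , a≡) , (i , <⇒≤ i<k , b≡)

  link-on-path : ∀ {a b} → SymClosure (PathEdges k x) a b → OnPath a × OnPath b
  link-on-path (fwd e) = edge-on-path e
  link-on-path (bwd e) = swap (edge-on-path e)

  ≈⇒≡⊎on-path : ∀ {a b} → a ≈ b → a ≡ b ⊎ (OnPath a × OnPath b)
  ≈⇒≡⊎on-path ε = inj₁ refl
  ≈⇒≡⊎on-path (e ◅ rest) with link-on-path e | ≈⇒≡⊎on-path rest
  ... | qa , qc | inj₁ refl = inj₂ (qa , qc)
  ... | qa , _  | inj₂ (_ , qb) = inj₂ (qa , qb)

  _≈?_ : ∀ a b → Dec (a ≈ b)
  a ≈? b = map′ [ (λ { refl → ε }) , (λ (qa , qb) → on-path-≈ qa qb) ]′ ≈⇒≡⊎on-path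
                (a ≟ᶠ b ⊎-dec (on-path? a ×-dec on-path? b))

-- Along P: u = p 0, x i = p (L + i) and v = p (L + k + R), where L = suc l and R = suc r.
module InteriorSatisfyingPath {n : ℕ} (G : Graph n) {d : ℕ} {u v : Fin n} (P : Path G u v)
  (l k r : ℕ) (x : ℕ → Fin n)
  (shape : len P ≡ suc l + k + suc r)
  (x-on-P : ∀ i → i ≤ k → x i ≡ vert P (suc l + i))
  (1≤k : 1 ≤ k)
  (diam : Diameter G d) (duv : Dist G u v d) (dom : DominatingPair G u v)
  (x₀-ii : ∀ z → Dist G v z d → DistEq G z (x 0) u (x 0))
  (xₖ-ii : ∀ z → Dist G u z d → DistEq G z (x k) v (x k))
  (x₀-iii : ∀ z → Dist G v z (d ∸ 1) → DistLe G z (x 0) u (x 0) ⊎ DistLe G z (x 1) u (x 0))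
  (xₖ-iii : ∀ z → Dist G u z (d ∸ 1) → DistLe G z (x k) v (x k) ⊎ DistLe G z (x (k ∸ 1)) v (x k))
  where

  open Walks G
  open Contraction G (PathEdges k x)
  open PathContraction k x

  L R : ℕ
  L = suc l
  R = suc r

  p : ℕ → Fin n
  p = vert P

  L+k≤len : L + k ≤ len P
  L+k≤len = subst (L + k ≤_) (≡.sym shape) (m≤m+n (L + k) R)

  len≡ : len P ≡ suc (L + k + r)
  len≡ = trans shape (+-suc (L + k) r)

  R+[L+k]≡len : R + (L + k) ≡ len P
  R+[L+k]≡len = trans (+-comm R (L + k)) (≡.sym shape)

  x₀≡ : x 0 ≡ p L
  x₀≡ = trans (x-on-P 0 z≤n) (cong p (+-identityʳ L))

  xₖ≡ : x k ≡ p (L + k)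
  xₖ≡ = x-on-P k ≤-refl

  u→x₀ : Walk G u (x 0) L
  u→x₀ = subst₂ (λ a b → Walk G a b L) (start P) (≡.sym (x-on-P 0 z≤n))
           (segment P L 0 (≤-trans (+-monoʳ-≤ L z≤n) L+k≤len))

  v→xₖ : Walk G v (x k) R
  v→xₖ = subst₂ (λ a b → Walk G a b R) (trans (cong p R+[L+k]≡len) (end P)) (≡.sym xₖ≡)
           (reverse (segment P R (L + k) (≤-reflexive R+[L+k]≡len)))

  NearQ : Fin n → ℕ → Set
  NearQ w m = ∃[ i ] (i ≤ k × WalkWithin w (x i) m)

  nearQ-mono : ∀ {w m m'} → NearQ w m → m ≤ m' → NearQ w m'
  nearQ-mono (i , i≤k , w~) m≤m' = i , i≤k , within-mono w~ m≤m'

  near-u : ∀ {w} → WalkWithin w u 1 → NearQ w L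
  near-u w~u = [ (λ w~x₀ → 0 , z≤n , w~x₀) , (λ w~x₁ → 1 , 1≤k , w~x₁) ]′
                 (near-diametral-end diam duv w~u u→x₀ x₀-ii x₀-iii)

  near-v : ∀ {w} → WalkWithin w v 1 → NearQ w R
  near-v w~v = [ (λ w~xₖ → k , ≤-refl , w~xₖ) , (λ w~xₖ₋₁ → k ∸ 1 , m∸n≤m k 1 , w~xₖ₋₁) ]′
                 (near-diametral-end diam (dist-sym duv) w~v v→xₖ xₖ-ii xₖ-iii)

  data Zone (w : Fin n) : Set where
    left   : ∀ {t} → t < L → WalkWithin w (p t) 1 → Zone w
    middle : NearQ w 1 → Zone w
    right  : ∀ {t} → L + k < t → t ≤ len P → WalkWithin w (p t) 1 → Zone w

  zone : ∀ w → Zone w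
  zone w with dominated P dom w
  ... | t , t≤len , w~pt with t <? L
  ...   | yes t<L = left t<L w~pt
  ...   | no t≮L with t ≤? L + k
  ...     | yes t≤L+k = middle (t ∸ L , i≤k , subst (λ b → WalkWithin w b 1) (≡.sym x-at-t) w~pt)
    where
    i≤k : t ∸ L ≤ k
    i≤k = m≤n+o⇒m∸n≤o t L t≤L+k
    x-at-t : x (t ∸ L) ≡ p t
    x-at-t = trans (x-on-P _ i≤k) (cong p (m+[n∸m]≡n (≮⇒≥ t≮L)))
  ...     | no t≰L+k = right (≰⇒> t≰L+k) t≤len w~pt

  left-near : ∀ {w t} → t < L → WalkWithin w (p t) 1 → NearQ w L
  left-near {w} {zero} _ w~p₀ = near-u (subst (λ b → WalkWithin w b 1) (start P) w~p₀)
  left-near {w} {suc t} t<L w~pt =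
    0 , z≤n , subst (λ b → WalkWithin w b L) (≡.sym x₀≡) (within-++ w~pt
      (segment-within P (≤-trans (<⇒≤ t<L) L≤len) L≤len
        (≤-trans (<⇒≤ t<L) (m≤m+n L l)) (s≤s (m≤n+m l t))))
    where
    L≤len : L ≤ len P
    L≤len = ≤-trans (m≤m+n L k) L+k≤len

  right-near : ∀ {w t} → L + k < t → t ≤ len P → WalkWithin w (p t) 1 → NearQ w R
  right-near {w} L+k<t t≤len w~pt with m≤n⇒m<n∨m≡n t≤len
  ... | inj₂ refl = near-v (subst (λ b → WalkWithin w b 1) (end P) w~pt)
  ... | inj₁ t<len =
    k , ≤-refl , subst (λ b → WalkWithin w b R) (≡.sym xₖ≡) (within-++ w~pt
      (segment-within P t≤len L+k≤len
        (s≤s⁻¹ (subst (_ <_) len≡ t<len)) (≤-trans (<⇒≤ L+k<t) (m≤m+n _ r))))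

  left-left : ∀ {a b ta tb} → ta < L → tb < L →
    WalkWithin a (p ta) 1 → WalkWithin b (p tb) 1 → WalkWithin a b (L + R)
  left-left {ta = ta} {tb = tb} ta<L tb<L a~ b~ =
    within-mono (dominated-within P a~ b~ (bound ta<L) (bound tb<L)
                  (≤-trans (s≤s⁻¹ ta<L) (m≤n+m l tb)) (≤-trans (s≤s⁻¹ tb<L) (m≤n+m l ta)))
                (+-monoʳ-≤ L (s≤s z≤n))
    where
    bound : ∀ {t} → t < L → t ≤ len P
    bound t<L = ≤-trans (<⇒≤ t<L) (≤-trans (m≤m+n L k) L+k≤len)

  right-right : ∀ {a b ta tb} → L + k < ta → L + k < tb → ta ≤ len P → tb ≤ len P →
    WalkWithin a (p ta) 1 → WalkWithin b (p tb) 1 → WalkWithin a b (L + R)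
  right-right L+k<ta L+k<tb ta≤len tb≤len a~ b~ =
    within-mono (dominated-within P a~ b~ ta≤len tb≤len (gap ta≤len L+k<tb) (gap tb≤len L+k<ta))
                (≤-trans (≤-reflexive (+-comm R 1)) (+-monoˡ-≤ R (s≤s z≤n)))
    where
    gap : ∀ {t₁ t₂} → t₁ ≤ len P → L + k < t₂ → t₁ ≤ t₂ + r
    gap t₁≤len L+k<t₂ = ≤-trans t₁≤len (subst (_≤ _) (≡.sym len≡) (+-monoˡ-≤ r L+k<t₂))

  through-Q : ∀ {a b m₁ m₂} → NearQ a m₁ → NearQ b m₂ → CWalkWithin a b (m₁ + m₂)
  through-Q (i , i≤k , a~) (j , j≤k , b~) =
    cwithin-join (within⇒cwithin _≈?_ a~) (on-path-≈ (i , i≤k , refl) (j , j≤k , refl))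
                 (within⇒cwithin _≈?_ (within-reverse b~))

  R+L≤L+R : R + L ≤ L + R
  R+L≤L+R = ≤-reflexive (+-comm R L)

  contracted-within : ∀ a b → CWalkWithin a b (L + R)
  contracted-within a b with zone a | zone b
  ... | left ta<L a~ | left tb<L b~ = within⇒cwithin _≈?_ (left-left ta<L tb<L a~ b~)
  ... | left ta<L a~ | middle qb = through-Q (left-near ta<L a~) (nearQ-mono qb (s≤s z≤n))
  ... | left ta<L a~ | right gb tb≤ b~ = through-Q (left-near ta<L a~) (right-near gb tb≤ b~)
  ... | middle qa | left tb<L b~ =
    cwithin-mono (through-Q (nearQ-mono qa (s≤s z≤n)) (left-near tb<L b~)) R+L≤L+R
  ... | middle qa | middle qb = through-Q (nearQ-mono qa (s≤s z≤n)) (nearQ-mono qb (s≤s z≤n))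
  ... | middle qa | right gb tb≤ b~ = through-Q (nearQ-mono qa (s≤s z≤n)) (right-near gb tb≤ b~)
  ... | right ga ta≤ a~ | left tb<L b~ =
    cwithin-mono (through-Q (right-near ga ta≤ a~) (left-near tb<L b~)) R+L≤L+R
  ... | right ga ta≤ a~ | middle qb =
    cwithin-mono (through-Q (right-near ga ta≤ a~) (nearQ-mono qb (s≤s z≤n))) R+L≤L+R
  ... | right ga ta≤ a~ | right gb tb≤ b~ =
    within⇒cwithin _≈?_ (right-right ga gb ta≤ tb≤ a~ b~)

  contracted-diam : ContractDiamAtMost G (PathEdges k x) (L + R)
  contracted-diam = contract-diam-≤ _≈?_ (adjacent? diam) contracted-within

gaps-sum : ∀ {L k R s d} → L + k + R ≡ d → k ≡ d ∸ s → s ≤ d → s ≡ L + R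
gaps-sum {L} {k} {R} {s} {d} shape k≡d∸s s≤d = +-cancelˡ-≡ k s (L + R) (begin
  k + s        ≡⟨ cong (_+ s) k≡d∸s ⟩
  d ∸ s + s    ≡⟨ m∸n+n≡m s≤d ⟩
  d            ≡⟨ ≡.sym shape ⟩
  L + k + R    ≡⟨ cong (_+ R) (+-comm L k) ⟩
  k + L + R    ≡⟨ +-assoc k L R ⟩
  k + (L + R)  ∎)
  where open ≡.≡-Reasoning

lemma13 : ∀ {n} (G : Graph n) (d s k : ℕ) (u v : Fin n) (x : ℕ → Fin n) →
    Connected G → AT-free G → Diameter G d →
    DiameterDominatingPair G d u v →
    2 ≤ s → s < d →
    k ≡ d ∸ s → Satisfying G d u v k x → u ≢ x 0 → v ≢ x k →
    ContractDiamAtMost G (PathEdges k x) s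
lemma13 G d s k u v x _ _ diam ((_ , duv) , dom) _ s<d k≡d∸s
  ((P , len≡d , zero , _ , x-on-P) , _) u≢x₀ _ =
  ⊥-elim (u≢x₀ (≡.sym (trans (x-on-P 0 z≤n) (start P))))
lemma13 G d s k u v x _ _ diam ((_ , duv) , dom) _ s<d k≡d∸s
  ((P , len≡d , suc l , j+k≤d , x-on-P) , _ , x₀-ii , xₖ-ii , x₀-iii , xₖ-iii) _ v≢xₖ =
  subst (ContractDiamAtMost G (PathEdges k x)) (≡.sym s≡L+R)
    (InteriorSatisfyingPath.contracted-diam G P l k r x shape x-on-P 1≤k
      diam duv dom x₀-ii xₖ-ii x₀-iii xₖ-iii)
  where
  xₖ-not-last : suc l + k ≢ d
  xₖ-not-last e = v≢xₖ (≡.sym (trans (x-on-P k ≤-refl)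
                    (trans (cong (vert P) (trans e (≡.sym len≡d))) (end P))))
  gap : ∃[ r ] (suc (suc l + k) + r ≡ d)
  gap = m≤n⇒∃[o]m+o≡n (≤∧≢⇒< j+k≤d xₖ-not-last)
  r : ℕ
  r = proj₁ gap
  d≡ : suc l + k + suc r ≡ d
  d≡ = trans (+-suc (suc l + k) r) (proj₂ gap)
  shape : len P ≡ suc l + k + suc r
  shape = trans len≡d (≡.sym d≡)
  s≡L+R : s ≡ suc l + suc r
  s≡L+R = gaps-sum {suc l} {R = suc r} d≡ k≡d∸s (<⇒≤ s<d)
  1≤k : 1 ≤ k
  1≤k = subst (1 ≤_) (≡.sym k≡d∸s) (m<n⇒0<n∸m s<d)
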